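{- Every cut language of a labelled marked RPN is a coverability language of some labelled marked RPN: for every labelled RPN $\mathcal N$ and state $s_0$ there exist a labelled RPN $\mathcal N'$, a state $s'_0$ and a finite set of states $S'_f$ with $\mathcal L_C(\mathcal N',s'_0,S'_f)=\mathcal L_R(\mathcal N,s_0,\{\emptyset\})$.
   Context: A Recursive Petri Net (RPN) is a tuple $\mathcal N=\langle P,T,W^+,W^-,\Omega\rangle$ where $P$ is a finite set of places, $T=T_{el}\uplus T_{ab}\uplus T_{\tau}$ is a finite set of transitions disjoint from $P$ (elementary, abstract and cut transitions), $W^-\in\mathbb N^{P\times T}$, $W^+\in\mathbb N^{P\times(T_{el}\uplus T_{ab})}$, and $\Omega:T_{ab}\to\mathbb N^P$. Write $W^{\pm}(t)\in\mathbb N^P$ for the column of $t$; markings are compared componentwise. A (concrete) state is either the empty tree $\emptyset$ or a finite rooted tree whose vertices (threads) are taken from a fixed countably infinite set $\mathcal V$, each vertex $v$ labelled by a marking $M_s(v)\in\mathbb N^P$ and each edge labelled by a vector in $\{W^+(t):t\in T_{ab}\}$. Firing rule: a thread $v$ of a state $s\neq\emptyset$ can fire $t$ if $W^-(t)\le M_s(v)$, giving $s\xrightarrow{(v,t)}s'$ where: if $t\in T_{el}$, the marking of $v$ becomes $M_s(v)-W^-(t)+W^+(t)$; if $t\in T_{ab}$, the marking of $v$ becomes $M_s(v)-W^-(t)$ and a new child $w$ of $v$ (a vertex never used before) is created with marking $\Omega(t)$ and edge $v\to w$ labelled $W^+(t)$; if $t\in T_\tau$, the subtree rooted at $v$ is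 deleted, and if $v$ is the root the result is $\emptyset$, otherwise the marking of the parent $u$ of $v$ is increased by the label of the edge $u\to v$. Quasi-order on states: $\emptyset\preceq s$ for every $s$; for $s\neq\emptyset$, $s\preceq s'$ iff there is an injective map $f$ from the vertices of $s$ to those of $s'$ with $M_s(v)\le M_{s'}(f(v))$ for all $v$ and, for every edge $v\to w$ of $s$ labelled $m$, an edge $f(v)\to f(w)$ of $s'$ labelled $m'\ge m$. A labelled RPN has a labelling $\lambda:T\to\Sigma\cup\{\varepsilon\}$ ($\Sigma$ finite), extended morphically to sequences. Coverability language: $\mathcal L_C(\mathcal N,s_0,S_f)=\{\lambda(\sigma)\mid s_0\xrightarrow{\sigma}s,\ s_f\preceq s\text{ for some }s_f\in S_f\}$ for a finite set of states $S_f$. The cut language of $(\mathcal N,s_0)$ is $\mathcal L_R(\mathcal N,s_0,\{\emptyset\})=\{\lambda(\sigma)\mid s_0\xrightarrow{\sigma}\emptyset\}$ ($\sigma$ finite). -}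

module Defs where

open import Data.Nat using (ℕ; _≤_; _+_; _∸_)
open import Data.Fin using (Fin)
open import Data.Vec using (Vec; zipWith)
open import Data.Vec.Relation.Binary.Pointwise.Inductive using (Pointwise)
open import Data.List using (List; []; _∷_; _++_; length; lookup; mapMaybe)
open import Data.List.Relation.Unary.Any using (Any)
open import Data.Maybe using (Maybe; just; nothing)
open import Data.Sum using (_⊎_; inj₁; inj₂)
open import Data.Product using (Σ; _×_; _,_; proj₁; proj₂; ∃)
open import Data.Empty using (⊥)
open import Data.Unit using (⊤)
open import Relation.Binary.PropositionalEquality using (_≡_)
open import Function.Definitions using (Injective)

Marking : ℕ → Set
Marking n = Vec ℕ n

_≤ᴹ_ : ∀ {n} → Marking n → Marking n → Set
_≤ᴹ_ = Pointwise _≤_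

_+ᴹ_ : ∀ {n} → Marking n → Marking n → Marking n
_+ᴹ_ = zipWith _+_

_∸ᴹ_ : ∀ {n} → Marking n → Marking n → Marking n
_∸ᴹ_ = zipWith _∸_

-- Labelled recursive Petri nets over alphabet Σ'
-- T = T_el ⊎ T_ab ⊎ T_τ ; W⁺ is only given on T_el ⊎ T_ab.

record LRPN (Σ' : Set) : Set where
  field
    nP  : ℕ
    nEl : ℕ
    nAb : ℕ
    nCut : ℕ
    W⁻   : Fin nEl ⊎ Fin nAb ⊎ Fin nCut → Marking nP
    W⁺el : Fin nEl → Marking nP
    W⁺ab : Fin nAb → Marking nP
    Ω    : Fin nAb → Marking nP
    lab  : Fin nEl ⊎ Fin nAb ⊎ Fin nCut → Maybe Σ'   -- nothing = ε

  Trans : Set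
  Trans = Fin nEl ⊎ Fin nAb ⊎ Fin nCut

-- Thread identities are
-- immaterial (languages are invariant under renaming), so vertices are
-- identified by their positions.

data Tree (n : ℕ) : Set where
  node : Marking n → List (Marking n × Tree n) → Tree n

-- a state is either ∅ (nothing) or a tree
State : ℕ → Set
State n = Maybe (Tree n)

data Pos {n : ℕ} : Tree n → Set where
  here : ∀ {t} → Pos t
  down : ∀ {m cs} (i : Fin (length cs)) → Pos (proj₂ (lookup cs i)) → Pos (node m cs)

markAt : ∀ {n} {t : Tree n} → Pos t → Marking n
markAt {t = node m cs} here = m
markAt (down i p) = markAt p

data Edge {n : ℕ} : {t : Tree n} → Pos t → Pos t → Marking n → Set where
  top    : ∀ {m cs} (i : Fin (length cs)) →
           Edge {t = node m cs} here (down i here) (proj₁ (lookup cs i))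
  deeper : ∀ {m cs} (i : Fin (length cs)) {v w l} →
           Edge {t = proj₂ (lookup cs i)} v w l →
           Edge {t = node m cs} (down i v) (down i w) l

_⊑ᵀ_ : ∀ {n} → Tree n → Tree n → Set
t ⊑ᵀ t' = Σ (Pos t → Pos t') λ f →
            Injective _≡_ _≡_ f
          × (∀ v → markAt v ≤ᴹ markAt (f v))
          × (∀ v w l → Edge v w l → Σ (Marking _) λ l' → Edge (f v) (f w) l' × l ≤ᴹ l')

_⪯_ : ∀ {n} → State n → State n → Set
nothing ⪯ s        = ⊤
just t  ⪯ nothing  = ⊥
just t  ⪯ just t'  = t ⊑ᵀ t'

module Semantics {Σ' : Set} (N : LRPN Σ') where
  open LRPN N

  ValidTree : Tree nP → Set
  ValidTree t = ∀ (v w : Pos t) l → Edge v w l → ∃ λ (a : Fin nAb) → l ≡ W⁺ab a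

  ValidState : State nP → Set
  ValidState nothing  = ⊤
  ValidState (just t) = ValidTree t

  -- result of a firing inside child c (with edge label l) of a vertex
  plug : Marking nP → List (Marking nP × Tree nP) → List (Marking nP × Tree nP) →
         Marking nP → State nP → Tree nP
  plug m xs ys l (just c') = node m (xs ++ (l , c') ∷ ys)
  plug m xs ys l nothing   = node (m +ᴹ l) (xs ++ ys)

  data Step : Tree nP → Trans → State nP → Set where
    el  : ∀ {m cs} (t : Fin nEl) → W⁻ (inj₁ t) ≤ᴹ m →
          Step (node m cs) (inj₁ t) (just (node ((m ∸ᴹ W⁻ (inj₁ t)) +ᴹ W⁺el t) cs))
    ab  : ∀ {m cs} (t : Fin nAb) → W⁻ (inj₂ (inj₁ t)) ≤ᴹ m →
          Step (node m cs) (inj₂ (inj₁ t))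
               (just (node (m ∸ᴹ W⁻ (inj₂ (inj₁ t))) ((W⁺ab t , node (Ω t) []) ∷ cs)))
    cut : ∀ {m cs} (t : Fin nCut) → W⁻ (inj₂ (inj₂ t)) ≤ᴹ m →
          Step (node m cs) (inj₂ (inj₂ t)) nothing
    child : ∀ {m l c r tr} (xs ys : List (Marking nP × Tree nP)) →
            Step c tr r →
            Step (node m (xs ++ (l , c) ∷ ys)) tr (just (plug m xs ys l r))

  data Run : State nP → List Trans → State nP → Set where
    [] : ∀ {s} → Run s [] s
    _∷_ : ∀ {t tr s σ s'} → Step t tr s → Run s σ s' → Run (just t) (tr ∷ σ) s'

  labelOf : List Trans → List Σ'
  labelOf = mapMaybe lab

  CovLang : State nP → List (State nP) → List Σ' → Set
  CovLang s₀ Sf w = Σ (List Trans) λ σ → Σ (State nP) λ s →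
                      Run s₀ σ s × Any (λ sf → sf ⪯ s) Sf × labelOf σ ≡ w

  CutLang : State nP → List Σ' → Set
  CutLang s₀ w = Σ (List Trans) λ σ → Run s₀ σ nothing × labelOf σ ≡ w

-- The new net runs a copy of s₀ as the only child of a fresh root.  Every
-- thread of the copy holds a token in a new place "gate" that every original
-- transition consumes (elementary transitions give it back, and a silent
-- refill transition lets a thread duplicate it before an abstract transition
-- spends it), while the root holds none and is therefore inert.  The edge from
-- the root to the copy carries one token of a second new place "done", which
-- is empty in every thread of the copy: a vertex with a "done" token exists
-- exactly when the copy has been cut away, so covering the one-vertex state
-- with one "done" token recognises precisely the cut runs of (N, s₀).
module Submission where

open import Defs
open import Data.Nat using (ℕ; zero; suc; _≤_; _+_; _∸_; z≤n; s≤s)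
open import Data.Nat.Properties using (+-identityʳ; 1+n≰n; m≤n+m; ∸-monoˡ-≤; ≤-trans)
open import Data.Fin using (Fin; zero; suc)
open import Data.Vec using ([]; _∷_; replicate)
open import Data.Vec.Properties using (zipWith-identityʳ)
open import Data.Vec.Relation.Binary.Pointwise.Inductive using ([]; _∷_)
open import Data.List using (List; []; _∷_; _++_; length; lookup)
open import Data.List.Properties using (mapMaybe-++; ++-conicalʳ; ∷-injectiveʳ)
open import Data.List.Relation.Unary.All using (All; []; _∷_)
open import Data.List.Relation.Unary.Any using (here)
open import Data.Maybe using (Maybe; just; nothing)
open import Data.Sum using (_⊎_; inj₁; inj₂)
open import Data.Product using (Σ; _×_; _,_; proj₁; proj₂; ∃)
open import Data.Empty using (⊥; ⊥-elim)
open import Data.Unit using (⊤; tt)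
open import Function using (flip)
open import Relation.Nullary using (¬_)
open import Relation.Binary.PropositionalEquality
  using (_≡_; refl; sym; trans; cong; subst; module ≡-Reasoning)

module RunProperties {Σ' : Set} (N : LRPN Σ') where
  open LRPN N
  open Semantics N

  _++ᴿ_ : ∀ {s s₁ s₂ σ₁ σ₂} → Run s σ₁ s₁ → Run s₁ σ₂ s₂ → Run s (σ₁ ++ σ₂) s₂
  [] ++ᴿ ρ = ρ
  (st ∷ ρ₁) ++ᴿ ρ = st ∷ (ρ₁ ++ᴿ ρ)

  run-child : ∀ {m l c σ r} xs ys → Run (just c) σ r →
              Run (just (node m (xs ++ (l , c) ∷ ys))) σ (just (plug m xs ys l r))
  run-child xs ys [] = []
  run-child xs ys (_∷_ {s = just _} st ρ) = child xs ys st ∷ run-child xs ys ρ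
  run-child xs ys (_∷_ {s = nothing} st []) = child xs ys st ∷ []

module Simulation {Σ' : Set} (A B : LRPN Σ')
  (_∼_ : State (LRPN.nP A) → State (LRPN.nP B) → Set) where
  private
    module A = Semantics A
    module B = Semantics B
  open RunProperties B using (_++ᴿ_)

  StepSimulation : Set
  StepSimulation = ∀ {t tr r s'} → just t ∼ s' → A.Step t tr r →
    ∃ λ σ' → ∃ λ r' → B.Run s' σ' r' × r ∼ r' × B.labelOf σ' ≡ A.labelOf (tr ∷ [])

  simulate : StepSimulation → ∀ {s s' σ r} → s ∼ s' → A.Run s σ r →
    ∃ λ σ' → ∃ λ r' → B.Run s' σ' r' × r ∼ r' × B.labelOf σ' ≡ A.labelOf σ
  simulate step rel A.[] = [] , _ , B.[] , rel , refl
  simulate step rel (A._∷_ {tr = tr} {σ = σ} st ρ) with step rel st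
  ... | σ₁ , _ , ρ₁ , rel₁ , eq₁ with simulate step rel₁ ρ
  ... | σ₂ , r₂ , ρ₂ , rel₂ , eq₂ = σ₁ ++ σ₂ , r₂ , ρ₁ ++ᴿ ρ₂ , rel₂ , labels
    where
    open ≡-Reasoning
    labels : B.labelOf (σ₁ ++ σ₂) ≡ A.labelOf (tr ∷ σ)
    labels = begin
      B.labelOf (σ₁ ++ σ₂)                 ≡⟨ mapMaybe-++ (LRPN.lab B) σ₁ σ₂ ⟩
      B.labelOf σ₁ ++ B.labelOf σ₂         ≡⟨ cong (_++ B.labelOf σ₂) eq₁ ⟩
      A.labelOf (tr ∷ []) ++ B.labelOf σ₂  ≡⟨ cong (A.labelOf (tr ∷ []) ++_) eq₂ ⟩
      A.labelOf (tr ∷ []) ++ A.labelOf σ   ≡⟨ sym (mapMaybe-++ (LRPN.lab A) (tr ∷ []) σ) ⟩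
      A.labelOf (tr ∷ σ)                   ∎

flag : ∀ {n} → Marking (suc (suc n)) → ℕ
flag (_ ∷ f ∷ _) = f

flag-mono : ∀ {n} {u v : Marking (suc (suc n))} → u ≤ᴹ v → flag u ≤ flag v
flag-mono (_ ∷ f≤ ∷ _) = f≤

replicate-0≤ : ∀ {n} (m : Marking n) → replicate n 0 ≤ᴹ m
replicate-0≤ [] = []
replicate-0≤ (_ ∷ m) = z≤n ∷ replicate-0≤ m

module CutToCover {Σ' : Set} (N : LRPN Σ') where
  open LRPN N
  module S = Semantics N
  module R = RunProperties N

  -- Markings of the new net are written  gate ∷ done ∷ m.
  n' : ℕ
  n' = suc (suc nP)

  0ᴹ : Marking nP
  0ᴹ = replicate nP 0

  ∸0ᴹ+0ᴹ : (m : Marking nP) → (m ∸ᴹ 0ᴹ) +ᴹ 0ᴹ ≡ m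
  ∸0ᴹ+0ᴹ m = trans (cong (_+ᴹ 0ᴹ) (zipWith-identityʳ (λ _ → refl) m))
                   (zipWith-identityʳ +-identityʳ m)

  -- Elementary and abstract transition 0 are the new refill and finish
  -- transitions; transition suc t is the guarded copy of t.
  W⁻′ : Fin (suc nEl) ⊎ Fin (suc nAb) ⊎ Fin nCut → Marking n'
  W⁻′ (inj₁ zero) = 1 ∷ 0 ∷ 0ᴹ
  W⁻′ (inj₁ (suc t)) = 1 ∷ 0 ∷ W⁻ (inj₁ t)
  W⁻′ (inj₂ (inj₁ zero)) = 0 ∷ 2 ∷ 0ᴹ
  W⁻′ (inj₂ (inj₁ (suc a))) = 1 ∷ 0 ∷ W⁻ (inj₂ (inj₁ a))
  W⁻′ (inj₂ (inj₂ c)) = 1 ∷ 0 ∷ W⁻ (inj₂ (inj₂ c))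

  W⁺el′ : Fin (suc nEl) → Marking n'
  W⁺el′ zero = 2 ∷ 0 ∷ 0ᴹ
  W⁺el′ (suc t) = 1 ∷ 0 ∷ W⁺el t

  -- The finish transition needs two done tokens and so never fires; it is
  -- there only to make  finishEdge  a legal edge label.
  finishEdge : Marking n'
  finishEdge = 0 ∷ 1 ∷ 0ᴹ

  W⁺ab′ : Fin (suc nAb) → Marking n'
  W⁺ab′ zero = finishEdge
  W⁺ab′ (suc a) = 0 ∷ 0 ∷ W⁺ab a

  Ω′ : Fin (suc nAb) → Marking n'
  Ω′ zero = 0 ∷ 0 ∷ 0ᴹ
  Ω′ (suc a) = 1 ∷ 0 ∷ Ω a

  lab′ : Fin (suc nEl) ⊎ Fin (suc nAb) ⊎ Fin nCut → Maybe Σ'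
  lab′ (inj₁ zero) = nothing
  lab′ (inj₁ (suc t)) = lab (inj₁ t)
  lab′ (inj₂ (inj₁ zero)) = nothing
  lab′ (inj₂ (inj₁ (suc a))) = lab (inj₂ (inj₁ a))
  lab′ (inj₂ (inj₂ c)) = lab (inj₂ (inj₂ c))

  N' : LRPN Σ'
  N' = record { nP = n' ; nEl = suc nEl ; nAb = suc nAb ; nCut = nCut
              ; W⁻ = W⁻′ ; W⁺el = W⁺el′ ; W⁺ab = W⁺ab′ ; Ω = Ω′ ; lab = lab′ }

  module S' = Semantics N'
  module R' = RunProperties N'

  refill : ∀ {g m cs} → 1 ≤ g →
           S'.Step (node (g ∷ 0 ∷ m) cs) (inj₁ zero) (just (node ((g ∸ 1) + 2 ∷ 0 ∷ m) cs))
  refill {g} {m} {cs} g≥1 =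
    subst (λ m′ → S'.Step (node (g ∷ 0 ∷ m) cs) (inj₁ zero) (just (node ((g ∸ 1) + 2 ∷ 0 ∷ m′) cs)))
          (∸0ᴹ+0ᴹ m) (S'.el zero (g≥1 ∷ z≤n ∷ replicate-0≤ m))

  -- Forward simulation keeps every gate ≥ 1 (P = 1 ≤_); backwards a thread
  -- may spend its last gate token on an abstract transition (P = λ _ → ⊤).
  data Lifted (P : ℕ → Set) : Tree nP → Tree n' → Set
  data Liftedᴸ (P : ℕ → Set) : List (Marking nP × Tree nP) → List (Marking n' × Tree n') → Set

  data Lifted P where
    node : ∀ {g m cs cs'} → P g → Liftedᴸ P cs cs' → Lifted P (node m cs) (node (g ∷ 0 ∷ m) cs')

  data Liftedᴸ P where
    [] : Liftedᴸ P [] []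
    _∷_ : ∀ {l c c' cs cs'} → Lifted P c c' → Liftedᴸ P cs cs' →
          Liftedᴸ P ((l , c) ∷ cs) ((0 ∷ 0 ∷ l , c') ∷ cs')

  data Liftedˢ (P : ℕ → Set) : State nP → State n' → Set where
    nothing : Liftedˢ P nothing nothing
    just : ∀ {t t'} → Lifted P t t' → Liftedˢ P (just t) (just t')

  Liftedᴸ-++ : ∀ {P xs xs' ys ys'} → Liftedᴸ P xs xs' → Liftedᴸ P ys ys' → Liftedᴸ P (xs ++ ys) (xs' ++ ys')
  Liftedᴸ-++ [] ys = ys
  Liftedᴸ-++ (c ∷ xs) ys = c ∷ Liftedᴸ-++ xs ys

  Liftedᴸ-splitˡ : ∀ {P} xs {l c ys cs'} → Liftedᴸ P (xs ++ (l , c) ∷ ys) cs' →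
    ∃ λ xs' → ∃ λ c' → ∃ λ ys' →
      cs' ≡ xs' ++ (0 ∷ 0 ∷ l , c') ∷ ys' × Liftedᴸ P xs xs' × Lifted P c c' × Liftedᴸ P ys ys'
  Liftedᴸ-splitˡ [] (c ∷ ys) = [] , _ , _ , refl , [] , c , ys
  Liftedᴸ-splitˡ (_ ∷ xs) (x ∷ rest) with Liftedᴸ-splitˡ xs rest
  ... | xs' , c' , ys' , refl , xs~ , c~ , ys~ = _ ∷ xs' , c' , ys' , refl , x ∷ xs~ , c~ , ys~

  Liftedᴸ-splitʳ : ∀ {P} xs' {l' c' ys' cs} → Liftedᴸ P cs (xs' ++ (l' , c') ∷ ys') →
    ∃ λ xs → ∃ λ l → ∃ λ c → ∃ λ ys →
      cs ≡ xs ++ (l , c) ∷ ys × l' ≡ 0 ∷ 0 ∷ l × Liftedᴸ P xs xs' × Lifted P c c' × Liftedᴸ P ys ys'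
  Liftedᴸ-splitʳ [] (c ∷ ys) = [] , _ , _ , _ , refl , refl , [] , c , ys
  Liftedᴸ-splitʳ (_ ∷ xs') (x ∷ rest) with Liftedᴸ-splitʳ xs' rest
  ... | xs , l , c , ys , refl , refl , xs~ , c~ , ys~ = _ ∷ xs , l , c , ys , refl , refl , x ∷ xs~ , c~ , ys~

  Liftedᴸ-lookup : ∀ {P cs cs'} → Liftedᴸ P cs cs' → (i : Fin (length cs')) →
    ∃ λ (j : Fin (length cs)) →
      Lifted P (proj₂ (lookup cs j)) (proj₂ (lookup cs' i)) × proj₁ (lookup cs' i) ≡ 0 ∷ 0 ∷ proj₁ (lookup cs j)
  Liftedᴸ-lookup (c ∷ _) zero = zero , c , refl
  Liftedᴸ-lookup (_ ∷ cs) (suc i) with Liftedᴸ-lookup cs i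
  ... | j , c , eq = suc j , c , eq

  Lifted-edge : ∀ {P t t'} → Lifted P t t' → ∀ {v' w' l'} → Edge {t = t'} v' w' l' →
    ∃ λ (v : Pos t) → ∃ λ (w : Pos t) → ∃ λ l → Edge v w l × l' ≡ 0 ∷ 0 ∷ l
  Lifted-edge (node _ cs) (top i) with Liftedᴸ-lookup cs i
  ... | j , _ , eq = here , down j here , _ , top j , eq
  Lifted-edge (node _ cs) (deeper i e) with Liftedᴸ-lookup cs i
  ... | j , c , _ with Lifted-edge c e
  ... | v , w , l , e′ , eq = down j v , down j w , l , deeper j e′ , eq

  Lifted-valid : ∀ {P t t'} → S.ValidTree t → Lifted P t t' → S'.ValidTree t'
  Lifted-valid valid t~ _ _ _ e with Lifted-edge t~ e
  ... | v , w , l , e′ , refl with valid v w l e′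
  ... | a , refl = suc a , refl

  Lifted-flag : ∀ {P t t'} → Lifted P t t' → (p : Pos t') → flag (markAt p) ≡ 0
  Lifted-flag (node _ _) here = refl
  Lifted-flag (node _ cs) (down i p) with Liftedᴸ-lookup cs i
  ... | _ , c , _ = Lifted-flag c p

  lift : Tree nP → Tree n'
  liftᴸ : List (Marking nP × Tree nP) → List (Marking n' × Tree n')
  lift (node m cs) = node (1 ∷ 0 ∷ m) (liftᴸ cs)
  liftᴸ [] = []
  liftᴸ ((l , c) ∷ cs) = (0 ∷ 0 ∷ l , lift c) ∷ liftᴸ cs

  Lifted-lift : ∀ {P} → P 1 → (t : Tree nP) → Lifted P t (lift t)
  Liftedᴸ-liftᴸ : ∀ {P} → P 1 → (cs : List (Marking nP × Tree nP)) → Liftedᴸ P cs (liftᴸ cs)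
  Lifted-lift p1 (node m cs) = node p1 (Liftedᴸ-liftᴸ p1 cs)
  Liftedᴸ-liftᴸ p1 [] = []
  Liftedᴸ-liftᴸ p1 ((l , c) ∷ cs) = Lifted-lift p1 c ∷ Liftedᴸ-liftᴸ p1 cs

  Lifted-plug : ∀ {P g m xs xs' ys ys' l r r'} → P g → Liftedᴸ P xs xs' → Liftedᴸ P ys ys' →
    Liftedˢ P r r' → Lifted P (S.plug m xs ys l r) (S'.plug (g ∷ 0 ∷ m) xs' ys' (0 ∷ 0 ∷ l) r')
  Lifted-plug pg xs ys (just c) = node pg (Liftedᴸ-++ xs (c ∷ ys))
  Lifted-plug {P} {g} pg xs ys nothing = node (subst P (sym (+-identityʳ g)) pg) (Liftedᴸ-++ xs ys)

  forward-step : ∀ {t t' tr r} → Lifted (1 ≤_) t t' → S.Step t tr r →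
    ∃ λ σ' → ∃ λ r' → S'.Run (just t') σ' r' × Liftedˢ (1 ≤_) r r' × S'.labelOf σ' ≡ S.labelOf (tr ∷ [])
  forward-step (node {g} g≥1 cs) (S.el t p) =
    _ , _ , S'.el (suc t) (g≥1 ∷ z≤n ∷ p) S'.∷ S'.[] , just (node (m≤n+m 1 (g ∸ 1)) cs) , refl
  forward-step (node {g} g≥1 cs) (S.ab a p) =
    _ , _ , refill g≥1 S'.∷ (S'.ab (suc a) (gate≥1 ∷ z≤n ∷ p) S'.∷ S'.[]) ,
    just (node (∸-monoˡ-≤ 1 gate≥2) (node (s≤s z≤n) [] ∷ cs)) , refl
    where
    gate≥2 : 2 ≤ (g ∸ 1) + 2
    gate≥2 = m≤n+m 2 (g ∸ 1)
    gate≥1 : 1 ≤ (g ∸ 1) + 2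
    gate≥1 = ≤-trans (s≤s z≤n) gate≥2
  forward-step (node g≥1 _) (S.cut c p) = _ , _ , S'.cut c (g≥1 ∷ z≤n ∷ p) S'.∷ S'.[] , nothing , refl
  forward-step (node g≥1 cs) (S.child xs ys st) with Liftedᴸ-splitˡ xs cs
  ... | xs' , _ , ys' , refl , xs~ , c~ , ys~ with forward-step c~ st
  ... | σ' , _ , ρ , r~ , eq = σ' , _ , R'.run-child xs' ys' ρ , just (Lifted-plug g≥1 xs~ ys~ r~) , eq

  backward-step : ∀ {t t' tr r'} → Lifted (λ _ → ⊤) t t' → S'.Step t' tr r' →
    ∃ λ σ → ∃ λ r → S.Run (just t) σ r × Liftedˢ (λ _ → ⊤) r r' × S.labelOf σ ≡ S'.labelOf (tr ∷ [])
  backward-step (node {g} {m} {cs} {cs'} _ cs~) (S'.el zero _) = [] , _ , S.[] , just refilled , refl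
    where
    refilled : Lifted (λ _ → ⊤) (node m cs) (node ((g ∸ 1) + 2 ∷ 0 ∷ (m ∸ᴹ 0ᴹ) +ᴹ 0ᴹ) cs')
    refilled rewrite ∸0ᴹ+0ᴹ m = node tt cs~
  backward-step (node _ cs) (S'.el (suc t) (_ ∷ _ ∷ p)) = _ , _ , S.el t p S.∷ S.[] , just (node tt cs) , refl
  backward-step (node _ _) (S'.ab zero (_ ∷ () ∷ _))
  backward-step (node _ cs) (S'.ab (suc a) (_ ∷ _ ∷ p)) =
    _ , _ , S.ab a p S.∷ S.[] , just (node tt (node tt [] ∷ cs)) , refl
  backward-step (node _ _) (S'.cut c (_ ∷ _ ∷ p)) = _ , _ , S.cut c p S.∷ S.[] , nothing , refl
  backward-step (node _ cs') (S'.child xs' ys' st) with Liftedᴸ-splitʳ xs' cs'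
  ... | xs , _ , _ , ys , refl , refl , xs~ , c~ , ys~ with backward-step c~ st
  ... | σ , _ , ρ , r~ , eq = σ , _ , R.run-child xs ys ρ , just (Lifted-plug tt xs~ ys~ r~) , eq

  idle : Marking n'
  idle = 0 ∷ 0 ∷ 0ᴹ

  runningRoot : Tree n' → Tree n'
  runningRoot t' = node idle ((finishEdge , t') ∷ [])

  finishedRoot : Tree n'
  finishedRoot = node (idle +ᴹ finishEdge) []

  data Wrapped (P : ℕ → Set) : State nP → State n' → Set where
    running : ∀ {t t'} → Lifted P t t' → Wrapped P (just t) (just (runningRoot t'))
    finished : Wrapped P nothing (just finishedRoot)

  wrap : State nP → State n'
  wrap nothing = just finishedRoot
  wrap (just t) = just (runningRoot (lift t))

  Wrapped-wrap : ∀ {P} → P 1 → (s : State nP) → Wrapped P s (wrap s)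
  Wrapped-wrap p1 nothing = finished
  Wrapped-wrap p1 (just t) = running (Lifted-lift p1 t)

  Wrapped-plug : ∀ {P r r'} → Liftedˢ P r r' → Wrapped P r (just (S'.plug idle [] [] finishEdge r'))
  Wrapped-plug (just t~) = running t~
  Wrapped-plug nothing = finished

  leaf-valid : ∀ {m} → S'.ValidTree (node m [])
  leaf-valid _ _ _ (top ())
  leaf-valid _ _ _ (deeper () _)

  wrap-valid : (s : State nP) → S.ValidState s → S'.ValidState (wrap s)
  wrap-valid nothing _ = leaf-valid
  wrap-valid (just t) valid _ _ _ (top zero) = zero , refl
  wrap-valid (just t) valid _ _ _ (deeper zero e) =
    Lifted-valid valid (Lifted-lift {P = λ _ → ⊤} tt t) _ _ _ e

  gateless-disabled : ∀ {x v} tr → x ≤ 1 → ¬ (W⁻′ tr ≤ᴹ (0 ∷ x ∷ v))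
  gateless-disabled (inj₁ zero) _ (() ∷ _)
  gateless-disabled (inj₁ (suc t)) _ (() ∷ _)
  gateless-disabled (inj₂ (inj₁ zero)) x≤1 (_ ∷ 2≤x ∷ _) with ≤-trans 2≤x x≤1
  ... | s≤s ()
  gateless-disabled (inj₂ (inj₁ (suc a))) _ (() ∷ _)
  gateless-disabled (inj₂ (inj₂ c)) _ (() ∷ _)

  finished-stuck : ∀ {cs tr r'} → S'.Step (node (idle +ᴹ finishEdge) cs) tr r' → cs ≡ [] → ⊥
  finished-stuck (S'.el t p) _ = gateless-disabled (inj₁ t) (s≤s z≤n) p
  finished-stuck (S'.ab a p) _ = gateless-disabled (inj₂ (inj₁ a)) (s≤s z≤n) p
  finished-stuck (S'.cut c p) _ = gateless-disabled (inj₂ (inj₂ c)) (s≤s z≤n) p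
  finished-stuck (S'.child xs ys _) eq with ++-conicalʳ xs _ eq
  ... | ()

  running-step : ∀ {cs t' tr r'} → S'.Step (node idle cs) tr r' → cs ≡ (finishEdge , t') ∷ [] →
    ∃ λ r'' → S'.Step t' tr r'' × r' ≡ just (S'.plug idle [] [] finishEdge r'')
  running-step (S'.el t p) _ = ⊥-elim (gateless-disabled (inj₁ t) z≤n p)
  running-step (S'.ab a p) _ = ⊥-elim (gateless-disabled (inj₂ (inj₁ a)) z≤n p)
  running-step (S'.cut c p) _ = ⊥-elim (gateless-disabled (inj₂ (inj₂ c)) z≤n p)
  running-step (S'.child [] _ st) refl = _ , st , refl
  running-step (S'.child (_ ∷ xs) _ _) eq with ++-conicalʳ xs _ (∷-injectiveʳ eq)
  ... | ()

  forward : Simulation.StepSimulation N N' (Wrapped (1 ≤_))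
  forward (running t~) st with forward-step t~ st
  ... | σ' , _ , ρ , r~ , eq = σ' , _ , R'.run-child [] [] ρ , Wrapped-plug r~ , eq

  backward : Simulation.StepSimulation N' N (flip (Wrapped (λ _ → ⊤)))
  backward finished st = ⊥-elim (finished-stuck st refl)
  backward (running t~) st with running-step st refl
  ... | _ , st′ , refl with backward-step t~ st′
  ... | σ , _ , ρ , r~ , eq = σ , _ , ρ , Wrapped-plug r~ , eq

  target : Tree n'
  target = node finishEdge []

  finished-covers : target ⊑ᵀ finishedRoot
  finished-covers = (λ _ → here) , injective , marks , edges
    where
    injective : ∀ {p q : Pos target} → here ≡ here → p ≡ q
    injective {here} {here} _ = refl
    marks : (v : Pos target) → markAt v ≤ᴹ markAt {t = finishedRoot} here
    marks here = z≤n ∷ s≤s z≤n ∷ replicate-0≤ _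
    edges : ∀ (v w : Pos target) l → Edge v w l → ∃ λ l' → Edge {t = finishedRoot} here here l' × l ≤ᴹ l'
    edges _ _ _ (top ())
    edges _ _ _ (deeper () _)

  running-uncovered : ∀ {P t t'} → Lifted P t t' → ¬ (target ⊑ᵀ runningRoot t')
  running-uncovered {t' = t'} t~ (f , _ , marks , _) =
    1+n≰n (subst (1 ≤_) (flag-zero (f here)) (flag-mono (marks here)))
    where
    flag-zero : (p : Pos (runningRoot t')) → flag (markAt p) ≡ 0
    flag-zero here = refl
    flag-zero (down zero p) = Lifted-flag t~ p

  open Simulation using (simulate)

  cut⊆cov : ∀ s₀ {w} → S.CutLang s₀ w → S'.CovLang (wrap s₀) (just target ∷ []) w
  cut⊆cov s₀ (σ , ρ , eq) with simulate N N' _ forward (Wrapped-wrap (s≤s z≤n) s₀) ρ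
  ... | σ' , _ , ρ' , finished , eq' = σ' , _ , ρ' , here finished-covers , trans eq' eq

  cov⊆cut : ∀ s₀ {w} → S'.CovLang (wrap s₀) (just target ∷ []) w → S.CutLang s₀ w
  cov⊆cut s₀ (σ' , _ , ρ' , here covered , eq) with simulate N' N _ backward (Wrapped-wrap tt s₀) ρ'
  ... | σ , nothing , ρ , _ , eq' = σ , ρ , trans eq' eq
  ... | _ , just _ , _ , running t~ , _ = ⊥-elim (running-uncovered t~ covered)

proposition9 : (k : ℕ) (N : LRPN (Fin k)) (s₀ : State (LRPN.nP N)) →
    Semantics.ValidState N s₀ →
    Σ (LRPN (Fin k)) λ N' → Σ (State (LRPN.nP N')) λ s₀' → Σ (List (State (LRPN.nP N'))) λ Sf' →
      Semantics.ValidState N' s₀' × All (Semantics.ValidState N') Sf' ×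
      (∀ (w : List (Fin k)) →
        (Semantics.CovLang N' s₀' Sf' w → Semantics.CutLang N s₀ w) ×
        (Semantics.CutLang N s₀ w → Semantics.CovLang N' s₀' Sf' w))
proposition9 k N s₀ valid =
  N' , wrap s₀ , just target ∷ [] , wrap-valid s₀ valid , leaf-valid ∷ [] ,
  λ w → cov⊆cut s₀ , cut⊆cov s₀
  where open CutToCover N
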